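{- Let $k,m_1,\dots,m_k$ and $t$ be positive integers, and let $[k]=M_1\cup\dots\cup M_t$ be a nontrivial partition of $[k]$ into pairwise disjoint sets. For each $i\in[k]$ and $j\in[t]$ define $m_i^{(j)}=m_i$ if $i\in M_j$ and $m_i^{(j)}=m_i-1$ otherwise. Then $$\bar{R}(m_1,\ldots,m_k)\le\sum_{j=1}^t\bar{R}(m_1^{(j)},\dots,m_k^{(j)})-t+2.$$
   Context: $[n]=\{1,\dots,n\}$. An edge-coloring of $K_n$ with $k$ colors is a map $f:\binom{[n]}{2}\to[k]$; $\alpha_i(f)$ is the independence number of the graph on $[n]$ whose edges are the pairs of color $i$. For non-negative integers $a_1,\dots,a_k$, $\bar{R}(a_1,\dots,a_k)$ is the least positive integer $N$ such that every edge-coloring $f$ of $K_N$ with $k$ colors has some $i$ with $\alpha_i(f)\ge a_i$. -}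

module Defs where

open import Data.Nat using (ℕ; zero; suc; _∸_; _≤_; _≥_; _<_)
open import Data.Fin using (Fin; _≟_)
open import Data.Fin.Subset using (Subset; _∈_; ∣_∣)
open import Data.Product using (Σ; ∃; _×_)
open import Relation.Binary.PropositionalEquality using (_≡_; _≢_)
open import Relation.Nullary using (¬_; yes; no)

-- An edge-coloring of K_N with k colors: a symmetric map on pairs of vertices.
-- The values f x x on the diagonal are irrelevant (never used).
record EdgeColoring (N k : ℕ) : Set where
  field
    col  : Fin N → Fin N → Fin k
    symm : ∀ x y → col x y ≡ col y x
open EdgeColoring public

IsIndep : ∀ {N k} → EdgeColoring N k → Fin k → Subset N → Set
IsIndep f i S = ∀ x y → x ∈ S → y ∈ S → x ≢ y → ¬ (col f x y ≡ i)

αAtLeast : ∀ {N k} → EdgeColoring N k → Fin k → ℕ → Set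
αAtLeast f i a = Σ (Subset _) λ S → IsIndep f i S × a ≤ ∣ S ∣

Good : ∀ {k} → (Fin k → ℕ) → ℕ → Set
Good {k} a N = (f : EdgeColoring N k) → ∃ λ i → αAtLeast f i (a i)

IsRbar : ∀ {k} → (Fin k → ℕ) → ℕ → Set
IsRbar a N = 1 ≤ N × Good a N × (∀ M → 1 ≤ M → Good a M → N ≤ M)

-- m_i^{(j)} for the partition given by p (i ∈ M_{p i}).
mj : ∀ {k t} → (Fin k → ℕ) → (Fin k → Fin t) → Fin t → Fin k → ℕ
mj m p j i with p i ≟ j
... | yes _ = m i
... | no _  = m i ∸ 1

-- Put N = Σⱼ R̄(m⁽ʲ⁾) − t + 2 and single out the vertex 0 of K_N. Sorting every other vertex u
-- by the part j = p (f 0 u) containing the colour of the edge 0u, the pigeonhole principle gives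
-- a class of at least R̄(m⁽ʲ⁾) vertices, on which some colour i has an independent set of size
-- m_i⁽ʲ⁾. If i ∈ M_j this is already m_i; otherwise no edge from 0 into the class has colour i,
-- so 0 can be added. Hence N is good, and since goodness of a given N is decidable (there are
-- finitely many colourings), a least positive good N exists below it.
module Submission where

open import Defs
open import Data.Bool.Base using (true; false; if_then_else_)
open import Data.Fin using (Fin; zero; suc; _≟_; inject≤; combine; remQuot; finToFun; funToFin)
open import Data.Fin.Properties
  using (all?; any?; suc-injective; inject≤-injective; remQuot-combine; finToFun-funToFin)
open import Data.Fin.Subset using (Subset; _∈_; _∉_; ∣_∣; inside; outside; ⊥; ⁅_⁆; _∪_)
open import Data.Fin.Subset.Properties
  using (_∈?_; anySubset?; ∉⊥; ∣⊥∣≡0; x∈p∪q⁻; x∈⁅y⁆⇒x≡y; ∪-identityʳ)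
open import Data.Nat using (ℕ; zero; suc; _+_; _*_; _∸_; _≤_; _<_; _≤?_; z≤n; s≤s; s≤s⁻¹)
open import Data.Nat.Properties
  using ( +-0-commutativeMonoid; +-mono-≤; +-comm; +-∸-comm; m∸n+n≡m; m≤n+m∸n; n≤1+n; n<1+n
        ; ≤-reflexive; ≤-trans; <⇒≱; ≰⇒>; ≮⇒≥; m<n⇒m<1+n; m<1+n⇒m<n∨m≡n; module ≤-Reasoning)
open import Algebra.Properties.CommutativeMonoid.Sum +-0-commutativeMonoid
  using (sum-syntax; sum-cong-≗; ∑-distrib-+; sum-replicate-zero)
open import Data.Product as Product using (Σ; ∃; _×_; _,_; proj₁; proj₂; map₁; map₂; uncurry)
open import Data.Sum as Sum using (_⊎_; inj₁; inj₂; [_,_]′)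
open import Data.Vec using (_∷_; []; here; there; sum; tabulate)
open import Function using (_∘_; _$_; const)
open import Function.Definitions using (Injective)
open import Relation.Binary.PropositionalEquality
open import Relation.Nullary using (¬_; Dec; yes; no; does; contradiction; ¬?; _×-dec_; _→-dec_)
open import Relation.Nullary.Decidable using (map′)
open import Relation.Unary using (Decidable)

sum-tabulate : ∀ {n} (f : Fin n → ℕ) → sum (tabulate f) ≡ ∑[ i < n ] f i
sum-tabulate {zero}  f = refl
sum-tabulate {suc n} f = cong (f zero +_) (sum-tabulate (f ∘ suc))

∑-mono-≤ : ∀ {n} {f g : Fin n → ℕ} → (∀ i → f i ≤ g i) → ∑[ i < n ] f i ≤ ∑[ i < n ] g i
∑-mono-≤ {zero}  f≤g = z≤n
∑-mono-≤ {suc n} f≤g = +-mono-≤ (f≤g zero) (∑-mono-≤ (f≤g ∘ suc))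

∑-1 : ∀ n → ∑[ i < n ] 1 ≡ n
∑-1 zero    = refl
∑-1 (suc n) = cong suc (∑-1 n)

δ : ∀ {n} → Fin n → Fin n → ℕ
δ a i = if does (a ≟ i) then 1 else 0

∑-δ : ∀ {n} (a : Fin n) → ∑[ i < n ] δ a i ≡ 1
∑-δ {suc n} zero    = cong suc (sum-replicate-zero n)
∑-δ {suc n} (suc a) = ∑-δ a

∣b∷p∣ : ∀ {n} b (p : Subset n) → ∣ b ∷ p ∣ ≡ (if b then 1 else 0) + ∣ p ∣
∣b∷p∣ true  p = refl
∣b∷p∣ false p = refl

∣p∪⁅x⁆∣≡1+∣p∣ : ∀ {n} {x : Fin n} (p : Subset n) → x ∉ p → ∣ p ∪ ⁅ x ⁆ ∣ ≡ suc ∣ p ∣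
∣p∪⁅x⁆∣≡1+∣p∣ {x = zero}  (inside  ∷ p) x∉p = contradiction here x∉p
∣p∪⁅x⁆∣≡1+∣p∣ {x = zero}  (outside ∷ p) x∉p = cong (suc ∘ ∣_∣) (∪-identityʳ p)
∣p∪⁅x⁆∣≡1+∣p∣ {x = suc x} (inside  ∷ p) x∉p = cong suc (∣p∪⁅x⁆∣≡1+∣p∣ p (x∉p ∘ there))
∣p∪⁅x⁆∣≡1+∣p∣ {x = suc x} (outside ∷ p) x∉p = ∣p∪⁅x⁆∣≡1+∣p∣ p (x∉p ∘ there)

x∈p∪⁅y⁆⁻ : ∀ {n} {x : Fin n} p y → x ∈ p ∪ ⁅ y ⁆ → x ∈ p ⊎ x ≡ y
x∈p∪⁅y⁆⁻ p y x∈ = Sum.map₂ (x∈⁅y⁆⇒x≡y y) (x∈p∪q⁻ p ⁅ y ⁆ x∈)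

enumerate : ∀ {n} (p : Subset n) → Fin ∣ p ∣ → Fin n
enumerate (inside  ∷ p) zero    = zero
enumerate (inside  ∷ p) (suc x) = suc (enumerate p x)
enumerate (outside ∷ p) x       = suc (enumerate p x)

enumerate-∈ : ∀ {n} (p : Subset n) x → enumerate p x ∈ p
enumerate-∈ (inside  ∷ p) zero    = here
enumerate-∈ (inside  ∷ p) (suc x) = there (enumerate-∈ p x)
enumerate-∈ (outside ∷ p) x       = there (enumerate-∈ p x)

enumerate-injective : ∀ {n} (p : Subset n) → Injective _≡_ _≡_ (enumerate p)
enumerate-injective (inside  ∷ p) {zero}  {zero}  _  = refl
enumerate-injective (inside  ∷ p) {suc x} {suc y} eq =
  cong suc (enumerate-injective p (suc-injective eq))
enumerate-injective (outside ∷ p)                 eq = enumerate-injective p (suc-injective eq)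

image : ∀ {m n} → (Fin m → Fin n) → Subset m → Subset n
image ι []            = ⊥
image ι (inside  ∷ p) = image (ι ∘ suc) p ∪ ⁅ ι zero ⁆
image ι (outside ∷ p) = image (ι ∘ suc) p

∈-image⁻ : ∀ {m n} (ι : Fin m → Fin n) p {y} → y ∈ image ι p → ∃ λ x → x ∈ p × ι x ≡ y
∈-image⁻ ι []            y∈ = contradiction y∈ ∉⊥
∈-image⁻ ι (outside ∷ p) y∈ = Product.map suc (map₁ there) (∈-image⁻ (ι ∘ suc) p y∈)
∈-image⁻ ι (inside  ∷ p) y∈ with x∈p∪⁅y⁆⁻ (image (ι ∘ suc) p) (ι zero) y∈
... | inj₁ y∈′  = Product.map suc (map₁ there) (∈-image⁻ (ι ∘ suc) p y∈′)
... | inj₂ refl = zero , here , refl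

∣image∣ : ∀ {m n} {ι : Fin m → Fin n} → Injective _≡_ _≡_ ι → ∀ p → ∣ image ι p ∣ ≡ ∣ p ∣
∣image∣ {n = n}  ι-inj []            = ∣⊥∣≡0 n
∣image∣          ι-inj (outside ∷ p) = ∣image∣ (suc-injective ∘ ι-inj) p
∣image∣ {ι = ι} ι-inj (inside  ∷ p) =
  trans (∣p∪⁅x⁆∣≡1+∣p∣ (image (ι ∘ suc) p) ι₀∉) (cong suc (∣image∣ (suc-injective ∘ ι-inj) p))
  where
  ι₀∉ : ι zero ∉ image (ι ∘ suc) p
  ι₀∉ ι₀∈ with ∈-image⁻ (ι ∘ suc) p ι₀∈
  ... | x , _ , ιx≡ι₀ with ι-inj ιx≡ι₀
  ... | ()

fiber : ∀ {n t} → (Fin n → Fin t) → Fin t → Subset n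
fiber q j = tabulate λ u → does (q u ≟ j)

∈-fiber⁻ : ∀ {n t} (q : Fin n → Fin t) j {u} → u ∈ fiber q j → q u ≡ j
∈-fiber⁻ q j {zero} u∈ with q zero ≟ j
... | yes qu≡j = qu≡j
∈-fiber⁻ q j {suc u} (there u∈) = ∈-fiber⁻ (q ∘ suc) j u∈

∑-∣fiber∣ : ∀ {n t} (q : Fin n → Fin t) → ∑[ j < t ] ∣ fiber q j ∣ ≡ n
∑-∣fiber∣ {zero}  {t} q = sum-replicate-zero t
∑-∣fiber∣ {suc n} {t} q = begin
  ∑[ j < t ] ∣ fiber q j ∣
    ≡⟨ sum-cong-≗ (λ j → ∣b∷p∣ (does (q zero ≟ j)) (fiber (q ∘ suc) j)) ⟩
  ∑[ j < t ] (δ (q zero) j + ∣ fiber (q ∘ suc) j ∣)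
    ≡⟨ ∑-distrib-+ (δ (q zero)) (λ j → ∣ fiber (q ∘ suc) j ∣) ⟩
  ∑[ j < t ] δ (q zero) j + ∑[ j < t ] ∣ fiber (q ∘ suc) j ∣
    ≡⟨ cong₂ _+_ (∑-δ (q zero)) (∑-∣fiber∣ (q ∘ suc)) ⟩
  suc n ∎
  where open ≡-Reasoning

pigeonhole : ∀ {n t} (q : Fin n → Fin t) (R : Fin t → ℕ) →
             ∑[ j < t ] R j < n + t → ∃ λ j → R j ≤ ∣ fiber q j ∣
pigeonhole {n} {t} q R ∑R<n+t with any? (λ j → R j ≤? ∣ fiber q j ∣)
... | yes large = large
... | no ¬large = contradiction n+t≤∑R (<⇒≱ ∑R<n+t)
  where
  open ≤-Reasoning
  n+t≤∑R : n + t ≤ ∑[ j < t ] R j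
  n+t≤∑R = begin
    n + t                                     ≡⟨ +-comm n t ⟩
    t + n                                     ≡⟨ sym (cong₂ _+_ (∑-1 t) (∑-∣fiber∣ q)) ⟩
    ∑[ j < t ] 1 + ∑[ j < t ] ∣ fiber q j ∣   ≡⟨ sym (∑-distrib-+ (const 1) (λ j → ∣ fiber q j ∣)) ⟩
    ∑[ j < t ] suc ∣ fiber q j ∣              ≤⟨ ∑-mono-≤ (λ j → ≰⇒> (¬large ∘ (j ,_))) ⟩
    ∑[ j < t ] R j                            ∎

restrict : ∀ {N n k} → EdgeColoring N k → (Fin n → Fin N) → EdgeColoring n k
restrict f ι = record { col = λ x y → col f (ι x) (ι y) ; symm = λ x y → symm f (ι x) (ι y) }

image-indep : ∀ {N n k} (f : EdgeColoring N k) {ι : Fin n → Fin N} {i S} →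
              IsIndep (restrict f ι) i S → IsIndep f i (image ι S)
image-indep f {ι} {S = S} indep y z y∈ z∈ y≢z with ∈-image⁻ ι S y∈ | ∈-image⁻ ι S z∈
... | x , x∈S , refl | x′ , x′∈S , refl = indep x x′ x∈S x′∈S (y≢z ∘ cong ι)

insert-indep : ∀ {N k} (f : EdgeColoring N k) {i S} v → IsIndep f i S →
               (∀ y → y ∈ S → col f v y ≢ i) → IsIndep f i (S ∪ ⁅ v ⁆)
insert-indep f {S = S} v indep v-free y z y∈ z∈ y≢z
  with x∈p∪⁅y⁆⁻ S v y∈ | x∈p∪⁅y⁆⁻ S v z∈
... | inj₁ y∈S | inj₁ z∈S = indep y z y∈S z∈S y≢z
... | inj₁ y∈S | inj₂ refl = v-free y y∈S ∘ trans (symm f v y)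
... | inj₂ refl | inj₁ z∈S = v-free z z∈S
... | inj₂ refl | inj₂ refl = contradiction refl y≢z

mj≡m : ∀ {k t} (m : Fin k → ℕ) (p : Fin k → Fin t) {j i} → p i ≡ j → mj m p j i ≡ m i
mj≡m m p {j} {i} pi≡j with p i ≟ j
... | yes _   = refl
... | no pi≢j = contradiction pi≡j pi≢j

m≤1+mj : ∀ {k t} (m : Fin k → ℕ) (p : Fin k → Fin t) j i → m i ≤ suc (mj m p j i)
m≤1+mj m p j i with p i ≟ j
... | yes _ = n≤1+n (m i)
... | no _  = m≤n+m∸n (m i) 1

image-αAtLeast : ∀ {N n k} (f : EdgeColoring N k) {ι : Fin n → Fin N} {i S a} →
  Injective _≡_ _≡_ ι → IsIndep (restrict f ι) i S → a ≤ ∣ S ∣ → αAtLeast f i a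
image-αAtLeast f {ι} {S = S} ι-inj S-indep a≤∣S∣ =
  image ι S , image-indep f S-indep , subst (_ ≤_) (sym (∣image∣ ι-inj S)) a≤∣S∣

insert-zero-αAtLeast : ∀ {n r k t} (f : EdgeColoring (suc n) k) (p : Fin k → Fin t)
  {ι : Fin r → Fin n} {i j S a} →
  Injective _≡_ _≡_ ι → (∀ x → p (col f zero (suc (ι x))) ≡ j) → p i ≢ j →
  IsIndep (restrict f (suc ∘ ι)) i S → a ≤ suc ∣ S ∣ → αAtLeast f i a
insert-zero-αAtLeast f p {ι} {i} {S = S′} {a} ι-inj ι-class pi≢j S′-indep a≤1+∣S′∣ =
  S ∪ ⁅ zero ⁆ , insert-indep f zero (image-indep f S′-indep) zero-free , a≤∣S∪0∣
  where
  S = image (suc ∘ ι) S′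

  zero-free : ∀ y → y ∈ S → col f zero y ≢ i
  zero-free y y∈S with ∈-image⁻ (suc ∘ ι) S′ y∈S
  ... | x , _ , refl = λ f₀y≡i → pi≢j (trans (cong p (sym f₀y≡i)) (ι-class x))

  zero∉S : zero ∉ S
  zero∉S 0∈S with ∈-image⁻ (suc ∘ ι) S′ 0∈S
  ... | _ , _ , ()

  a≤∣S∪0∣ : a ≤ ∣ S ∪ ⁅ zero ⁆ ∣
  a≤∣S∪0∣ = subst (a ≤_) (begin
    suc ∣ S′ ∣        ≡⟨ cong suc (sym (∣image∣ (ι-inj ∘ suc-injective) S′)) ⟩
    suc ∣ S ∣         ≡⟨ sym (∣p∪⁅x⁆∣≡1+∣p∣ S zero∉S) ⟩
    ∣ S ∪ ⁅ zero ⁆ ∣  ∎) a≤1+∣S′∣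
    where open ≡-Reasoning

αAtLeast-from-class : ∀ {k t n r} (m : Fin k → ℕ) (p : Fin k → Fin t) (f : EdgeColoring (suc n) k)
  {j} {ι : Fin r → Fin n} → Injective _≡_ _≡_ ι → (∀ x → p (col f zero (suc (ι x))) ≡ j) →
  Good (mj m p j) r → ∃ λ i → αAtLeast f i (m i)
αAtLeast-from-class m p f {j} {ι} ι-inj ι-class good with good (restrict f (suc ∘ ι))
... | i , S , S-indep , mj≤∣S∣ = i , in-or-off-class (p i ≟ j)
  where
  in-or-off-class : Dec (p i ≡ j) → αAtLeast f i (m i)
  in-or-off-class (yes pi≡j) =
    image-αAtLeast f (ι-inj ∘ suc-injective) S-indep (subst (_≤ ∣ S ∣) (mj≡m m p pi≡j) mj≤∣S∣)
  in-or-off-class (no pi≢j) =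
    insert-zero-αAtLeast f p ι-inj ι-class pi≢j S-indep (≤-trans (m≤1+mj m p j i) (s≤s mj≤∣S∣))

Good-from-classes : ∀ {k t} (m : Fin k → ℕ) (p : Fin k → Fin t) (R : Fin t → ℕ) →
  (∀ j → Good (mj m p j) (R j)) → ∀ n → ∑[ j < t ] R j ≤ n + t → Good m (2 + n)
Good-from-classes {t = t} m p R good n ∑R≤n+t f = from-large-class (pigeonhole class R (s≤s ∑R≤n+t))
  where
  class : Fin (suc n) → Fin t
  class u = p (col f zero (suc u))

  from-large-class : (∃ λ j → R j ≤ ∣ fiber class j ∣) → ∃ λ i → αAtLeast f i (m i)
  from-large-class (j , Rj≤∣Fj∣) = αAtLeast-from-class m p f ι-injective ι-class (good j)
    where
    ι : Fin (R j) → Fin (suc n)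
    ι x = enumerate (fiber class j) (inject≤ x Rj≤∣Fj∣)

    ι-injective : Injective _≡_ _≡_ ι
    ι-injective eq = inject≤-injective Rj≤∣Fj∣ Rj≤∣Fj∣ _ _ (enumerate-injective (fiber class j) eq)

    ι-class : ∀ x → class (ι x) ≡ j
    ι-class x = ∈-fiber⁻ class j (enumerate-∈ (fiber class j) _)

∀-function? : ∀ {m n} {P : (Fin m → Fin n) → Set} →
  (∀ {f g} → (∀ x → f x ≡ g x) → P f → P g) → Decidable P → Dec (∀ f → P f)
∀-function? P-resp P? =
  map′ (λ ∀P f → P-resp (finToFun-funToFin f) (∀P (funToFin f))) (λ ∀P → ∀P ∘ finToFun)
       (all? (P? ∘ finToFun))

IsIndep? : ∀ {N k} (f : EdgeColoring N k) i S → Dec (IsIndep f i S)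
IsIndep? f i S = all? λ x → all? λ y →
  x ∈? S →-dec y ∈? S →-dec ¬? (x ≟ y) →-dec ¬? (col f x y ≟ i)

αAtLeast? : ∀ {N k} (f : EdgeColoring N k) i a → Dec (αAtLeast f i a)
αAtLeast? f i a = anySubset? λ S → IsIndep? f i S ×-dec a ≤? ∣ S ∣

αAtLeast-cong : ∀ {N k} (f g : EdgeColoring N k) → (∀ x y → col f x y ≡ col g x y) →
                ∀ {i a} → αAtLeast f i a → αAtLeast g i a
αAtLeast-cong f g f≗g (S , S-indep , a≤∣S∣) =
  S , (λ x y x∈ y∈ x≢y → S-indep x y x∈ y∈ x≢y ∘ trans (f≗g x y)) , a≤∣S∣

mkColoring : ∀ {N k} (c : Fin N → Fin N → Fin k) → (∀ x y → c x y ≡ c y x) → EdgeColoring N k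
mkColoring c c-symm = record { col = c ; symm = c-symm }

GoodTable : ∀ {N k} → (Fin k → ℕ) → (Fin N → Fin N → Fin k) → Set
GoodTable a c = (c-symm : ∀ x y → c x y ≡ c y x) → ∃ λ i → αAtLeast (mkColoring c c-symm) i (a i)

GoodTable-cong : ∀ {N k} (a : Fin k → ℕ) {c d : Fin N → Fin N → Fin k} →
                 (∀ x y → c x y ≡ d x y) → GoodTable a c → GoodTable a d
GoodTable-cong a {c} {d} c≗d good d-symm =
  map₂ (αAtLeast-cong (mkColoring c c-symm) (mkColoring d d-symm) c≗d) (good c-symm)
  where
  c-symm : ∀ x y → c x y ≡ c y x
  c-symm x y = trans (c≗d x y) (trans (d-symm x y) (sym (c≗d y x)))

GoodTable? : ∀ {N k} (a : Fin k → ℕ) → Decidable (GoodTable {N} a)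
GoodTable? a c with all? (λ x → all? λ y → c x y ≟ c y x)
... | yes c-symm = map′ const (_$ c-symm)
                        (any? λ i → αAtLeast? (mkColoring c c-symm) i (a i))
... | no ¬c-symm = yes λ c-symm → contradiction c-symm ¬c-symm

Good? : ∀ {k} (a : Fin k → ℕ) N → Dec (Good a N)
Good? {k} a N =
  map′ (λ ∀good f → tables-good ∀good (col f) (symm f)) (λ good c → good ∘ mkColoring (table c))
       (∀-function? (λ c≗d → GoodTable-cong a (λ x y → c≗d (combine x y))) (GoodTable? a ∘ table))
  where
  table : (Fin (N * N) → Fin k) → Fin N → Fin N → Fin k
  table c x y = c (combine x y)

  tables-good : (∀ c → GoodTable a (table c)) → ∀ c → GoodTable a c
  tables-good ∀good c =
    GoodTable-cong a (λ x y → cong (uncurry c) (remQuot-combine x y))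
                     (∀good (uncurry c ∘ remQuot N))

Least : (ℕ → Set) → ℕ → Set
Least P n = P n × (∀ m → P m → n ≤ m)

least-below? : ∀ {P : ℕ → Set} → Decidable P → ∀ n →
               (∃ λ m → m < n × Least P m) ⊎ (∀ m → m < n → ¬ P m)
least-below? P? zero = inj₂ λ _ ()
least-below? P? (suc n) with least-below? P? n
... | inj₁ (m , m<n , least) = inj₁ (m , m<n⇒m<1+n m<n , least)
... | inj₂ none with P? n
...   | yes Pn = inj₁ (n , n<1+n n , Pn , λ m Pm → ≮⇒≥ λ m<n → none m m<n Pm)
...   | no ¬Pn = inj₂ λ m m<1+n → [ none m , (λ { refl → ¬Pn }) ]′ (m<1+n⇒m<n∨m≡n m<1+n)

least : ∀ {P : ℕ → Set} → Decidable P → ∀ {n} → P n → ∃ λ m → m ≤ n × Least P m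
least P? {n} Pn with least-below? P? (suc n)
... | inj₁ (m , m<1+n , least-m) = m , s≤s⁻¹ m<1+n , least-m
... | inj₂ none                  = contradiction Pn (none n (n<1+n n))

least-good⇒IsRbar : ∀ {k} {a : Fin k → ℕ} {N} → Least (λ M → 1 ≤ M × Good a M) N → IsRbar a N
least-good⇒IsRbar ((1≤N , good) , minimal) = 1≤N , good , λ M 1≤M good-M → minimal M (1≤M , good-M)

lemma3p2 : (k t : ℕ) → 1 ≤ k → 1 ≤ t →
    (m : Fin k → ℕ) → (∀ i → 1 ≤ m i) →
    (p : Fin k → Fin t) → (∀ j → ∃ λ i → p i ≡ j) →
    (R : Fin t → ℕ) → (∀ j → IsRbar (mj m p j) (R j)) →
    Σ ℕ λ N → IsRbar m N × N ≤ (sum (tabulate R) + 2) ∸ t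
lemma3p2 k t _ _ m _ p _ R R-rbar =
  let N , N≤2+∑R∸t , N-least = least (λ M → 1 ≤? M ×-dec Good? m M) (s≤s z≤n , good)
  in  N , least-good⇒IsRbar N-least , ≤-trans N≤2+∑R∸t (≤-reflexive bound)
  where
  ∑R = ∑[ j < t ] R j

  t≤∑R : t ≤ ∑R
  t≤∑R = subst (_≤ ∑R) (∑-1 t) (∑-mono-≤ (proj₁ ∘ R-rbar))

  good : Good m (2 + (∑R ∸ t))
  good = Good-from-classes m p R (proj₁ ∘ proj₂ ∘ R-rbar) (∑R ∸ t)
                          (≤-reflexive (sym (m∸n+n≡m t≤∑R)))

  bound : 2 + (∑R ∸ t) ≡ (sum (tabulate R) + 2) ∸ t
  bound = begin
    2 + (∑R ∸ t)                 ≡⟨ +-comm 2 (∑R ∸ t) ⟩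
    ∑R ∸ t + 2                   ≡⟨ sym (+-∸-comm 2 t≤∑R) ⟩
    (∑R + 2) ∸ t                 ≡⟨ cong (λ s → (s + 2) ∸ t) (sym (sum-tabulate R)) ⟩
    (sum (tabulate R) + 2) ∸ t   ∎
    where open ≡-Reasoning
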